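{- Let $x\le y$ in $\mathcal{P}(n;\epsilon)$ and $m=\rho(y)-\rho(x)$. For the edge-labeling $\lambda(u,v)=\mathcal{E}(v)\setminus\mathcal{E}(u)$ restricted to $[x,y]$, with the labels $\mathcal{E}(y)\setminus\mathcal{E}(x)$ identified with $\{1,\dots,m\}$ via the total order $(i,j)<(k,l)$ iff $j<l$, or $j=l$ and $i>k$, the $EL$-labeling of $[x,y]$ is snelling: for every maximal chain $x=x_0\lessdot x_1\lessdot\cdots\lessdot x_m=y$, the map $t\mapsto\lambda(x_{t-1},x_t)$ is a permutation of $\{1,\dots,m\}$.
   Context: A network on $n$ points is a set $E$ of pairs $(i,j)$ with $1\le i<j\le n$ (directed edges; $i$ a source, $j$ a sink) with no $(i,j),(j,k)\in E$, satisfying (B1): if $(i,k),(j,l)\in E$ with $i<j<k<l$ then $(j,k)\in E$. Let $\epsilon\in\{1,0,-1\}^n$ have first nonzero entry (if any) equal to $1$; $\mathcal{N}(n;\epsilon)$ is the set of such networks in which every source $i$ has $\epsilon_i=1$ and every sink $j$ has $\epsilon_j=-1$. $\mathcal{E}(x)$ is the edge set of $x$, $\rho(x)=|\mathcal{E}(x)|$; $x\lessdot y$ iff $\rho(y)=\rho(x)+1$ and $\mathcal{E}(x)\subset\mathcal{E}(y)$ (so $\mathcal{E}(y)\setminus\mathcal{E}(x)$ is a single edge); $x\le y$ iff there is a chain of covers from $x$ to $y$; $\mathcal{P}(n;\epsilon)=(\mathcal{N}(n;\epsilon),\le)$. -}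

module Defs where

open import Data.Bool using (Bool; true; false; _∧_; _∨_; not)
open import Data.Nat as ℕ using (ℕ; suc; _∸_; _<ᵇ_; _≡ᵇ_)
open import Data.Fin as Fin using (Fin; zero; suc; toℕ; inject₁; fromℕ)
open import Data.List using (List; length; filterᵇ; allFin; concatMap; map)
open import Data.Product using (Σ; _×_; _,_; proj₁; proj₂; ∃)
open import Relation.Binary.PropositionalEquality using (_≡_)
open import Relation.Nullary using (¬_)
open import Data.Empty using (⊥)
open import Relation.Binary.Construct.Closure.ReflexiveTransitive using (Star)

data Sgn : Set where
  pos zer neg : Sgn

-- ε ∈ {1,0,-1}^n (points 1..n are Fin n, i.e. 0..n-1) whose first nonzero
-- entry (if any) is 1.
FirstNonzeroPos : ∀ {n} → (Fin n → Sgn) → Set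
FirstNonzeroPos {n} ε =
  ∀ (i : Fin n) → ¬ (ε i ≡ zer) → (∀ (j : Fin n) → j Fin.< i → ε j ≡ zer) → ε i ≡ pos

EdgeSet : ℕ → Set
EdgeSet n = Fin n → Fin n → Bool

record IsNetwork {n : ℕ} (ε : Fin n → Sgn) (E : EdgeSet n) : Set where
  field
    ordered  : ∀ i j → E i j ≡ true → i Fin.< j
    noPath   : ∀ i j k → E i j ≡ true → E j k ≡ true → ⊥
    B1       : ∀ i j k l → E i k ≡ true → E j l ≡ true →
               i Fin.< j → j Fin.< k → k Fin.< l → E j k ≡ true
    sourcePos : ∀ i j → E i j ≡ true → ε i ≡ pos
    sinkNeg   : ∀ i j → E i j ≡ true → ε j ≡ neg

Net : (n : ℕ) → (Fin n → Sgn) → Set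
Net n ε = Σ (EdgeSet n) (IsNetwork ε)

𝓔 : ∀ {n ε} → Net n ε → EdgeSet n
𝓔 = proj₁

allPairs : (n : ℕ) → List (Fin n × Fin n)
allPairs n = concatMap (λ i → map (i ,_) (allFin n)) (allFin n)

ρ : ∀ {n ε} → Net n ε → ℕ
ρ {n} x = length (filterᵇ (λ p → 𝓔 x (proj₁ p) (proj₂ p)) (allPairs n))

_⊆E_ : ∀ {n} → EdgeSet n → EdgeSet n → Set
E ⊆E F = ∀ i j → E i j ≡ true → F i j ≡ true

_⋖_ : ∀ {n ε} → Net n ε → Net n ε → Set
x ⋖ y = (ρ y ≡ suc (ρ x)) × (𝓔 x ⊆E 𝓔 y) × ¬ (𝓔 y ⊆E 𝓔 x)

_≤P_ : ∀ {n ε} → Net n ε → Net n ε → Set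
_≤P_ = Star _⋖_

_≈N_ : ∀ {n ε} → Net n ε → Net n ε → Set
x ≈N y = ∀ i j → 𝓔 x i j ≡ 𝓔 y i j

inDiff : ∀ {n ε} → Net n ε → Net n ε → Fin n × Fin n → Bool
inDiff x y p = 𝓔 y (proj₁ p) (proj₂ p) ∧ not (𝓔 x (proj₁ p) (proj₂ p))

_≺ᵇ_ : ∀ {n} → Fin n × Fin n → Fin n × Fin n → Bool
(i , j) ≺ᵇ (k , l) = (toℕ j <ᵇ toℕ l) ∨ ((toℕ j ≡ᵇ toℕ l) ∧ (toℕ k <ᵇ toℕ i))

-- position (0-based) of edge e among the edges of 𝓔(y) ∖ 𝓔(x) in the above
-- order; this is the identification of 𝓔(y)∖𝓔(x) with {1,…,m}, shifted to {0,…,m-1}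
rankIn : ∀ {n ε} → Net n ε → Net n ε → Fin n × Fin n → ℕ
rankIn {n} x y e = length (filterᵇ (λ e' → inDiff x y e' ∧ (e' ≺ᵇ e)) (allPairs n))

record MaxChain {n ε} (x y : Net n ε) (m : ℕ) : Set where
  field
    c     : Fin (suc m) → Net n ε
    start : c zero ≈N x
    end   : c (fromℕ m) ≈N y
    cover : ∀ (t : Fin m) → c (inject₁ t) ⋖ c (suc t)

{-# OPTIONS --safe #-}
-- Along a maximal chain x = c₀ ⋖ c₁ ⋖ ⋯ ⋖ cₘ = y the edge sets increase, and
-- since ρ goes up by exactly one at each cover, each cover adds exactly one
-- edge, its label. An edge added at step s is still present at every later
-- step, so the labels are pairwise distinct, and they all lie in
-- 𝓔(y) ∖ 𝓔(x), a set with ρ y ∸ ρ x = m elements. The rank of an edge in the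
-- total order ≺ is injective on 𝓔(y) ∖ 𝓔(x) with values below m, so
-- t ↦ rank (label t) is an injective, hence bijective, self-map of Fin m.
module Submission where

open import Defs
open import Data.Nat using (ℕ; suc; _∸_; _+_; _≤_; _<_; _>_; z≤n; s≤s; s≤s⁻¹; _<ᵇ_)
open import Data.Nat.Properties
  using (<ᵇ⇒<; <⇒<ᵇ; ≡ᵇ⇒≡; ≡⇒≡ᵇ; m<m+n; m+n∸m≡n; m+n∸n≡m; +-suc; ≤⇒≯; ≤-refl;
         m≤n⇒m≤1+n; 1+n≰n; <⇒≢; <-isStrictTotalOrder)
open import Data.Fin as Fin using (Fin; zero; suc; toℕ; inject₁; fromℕ; fromℕ<; punchOut)
open import Data.Fin.Properties
  using (toℕ-injective; toℕ-inject₁; toℕ-fromℕ<; ≤fromℕ;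
         punchOut-injective; injective⇒≤; any?; <-cmp)
open import Data.Bool using (Bool; true; false; _∧_; not; T)
open import Data.Bool.Properties using (T-≡; T-∧; T-∨; ∧-zeroʳ)
open import Data.List using (List; []; _∷_; length; filterᵇ; allFin; map)
open import Data.List.Membership.Propositional using (_∈_)
open import Data.List.Membership.Propositional.Properties using (∈-allFin; ∈-map⁺; ∈-concatMap⁺)
open import Data.List.Relation.Unary.Any as Any using (here; there)
open import Data.Product using (Σ; ∃; _×_; _,_; proj₁; proj₂; uncurry)
open import Data.Product.Properties using (≡-dec)
open import Data.Product.Function.NonDependent.Propositional using (_×-⇔_)
open import Data.Product.Relation.Binary.Lex.Strict using (×-Lex; ×-isStrictTotalOrder)
open import Data.Sum using (_⊎_; inj₁; inj₂)
open import Data.Sum.Function.Propositional using (_⊎-⇔_)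
open import Function using (_∘_)
open import Level using (0ℓ)
open import Function.Bundles using (_⇔_; mk⇔; Equivalence)
open import Function.Construct.Composition using (_⇔-∘_)
open import Function.Construct.Symmetry using (⇔-sym)
open import Function.Definitions using (Injective; Surjective; Bijective)
open import Relation.Binary using (Rel; Reflexive; Transitive; IsStrictTotalOrder; tri<; tri≈; tri>)
import Relation.Binary.Construct.Flip.EqAndOrd as Flip
open import Relation.Binary.PropositionalEquality
  using (_≡_; _≢_; refl; sym; trans; cong; cong₂; subst; module ≡-Reasoning)
open import Relation.Nullary using (¬_; yes; no; contradiction)

open Equivalence using (to; from)

∧-true⁻ : ∀ {a b} → a ∧ b ≡ true → a ≡ true × b ≡ true
∧-true⁻ {true} {true} refl = refl , refl

∧-true⁺ : ∀ {a b} → a ≡ true → b ≡ true → a ∧ b ≡ true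
∧-true⁺ refl refl = refl

module _ {ℓ} {A : Set ℓ} where

  count : (A → Bool) → List A → ℕ
  count P xs = length (filterᵇ P xs)

  _⊆ᵇ_ : (A → Bool) → (A → Bool) → Set ℓ
  P ⊆ᵇ Q = ∀ x → P x ≡ true → Q x ≡ true

  _∖ᵇ_ : (A → Bool) → (A → Bool) → A → Bool
  (Q ∖ᵇ P) x = Q x ∧ not (P x)

  ⊆ᵇ-refl : ∀ {P : A → Bool} → P ⊆ᵇ P
  ⊆ᵇ-refl _ Pa = Pa

  ⊆ᵇ-trans : ∀ {P Q R : A → Bool} → P ⊆ᵇ Q → Q ⊆ᵇ R → P ⊆ᵇ R
  ⊆ᵇ-trans P⊆Q Q⊆R x = Q⊆R x ∘ P⊆Q x

  ⊆ᵇ-false : ∀ {P Q : A → Bool} {a} → P ⊆ᵇ Q → Q a ≡ false → P a ≡ false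
  ⊆ᵇ-false {P} {a = a} P⊆Q Qa with P a in Pa
  ... | true  = contradiction (trans (sym (P⊆Q a Pa)) Qa) λ ()
  ... | false = refl

  ∖ᵇ-true⁻ : ∀ {P Q : A → Bool} {a} → (Q ∖ᵇ P) a ≡ true → Q a ≡ true × P a ≡ false
  ∖ᵇ-true⁻ {P} {Q} {a} _ with Q a | P a
  ... | true | false = refl , refl

  count-pos : ∀ {P : A → Bool} {a xs} → a ∈ xs → P a ≡ true → 0 < count P xs
  count-pos {P} {xs = b ∷ xs} (here refl) Pa with P b
  ... | true = s≤s z≤n
  count-pos {P} {xs = b ∷ xs} (there a∈xs) Pa with P b
  ... | true = s≤s z≤n
  ... | false = count-pos a∈xs Pa

  count-pos⁻ : ∀ {P : A → Bool} xs → 0 < count P xs → ∃ λ a → P a ≡ true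
  count-pos⁻ {P} (a ∷ xs) 0<count with P a in Pa
  ... | true = a , Pa
  ... | false = count-pos⁻ xs 0<count

  count-⊆ : ∀ {P Q : A → Bool} → P ⊆ᵇ Q → ∀ xs → count Q xs ≡ count P xs + count (Q ∖ᵇ P) xs
  count-⊆ P⊆Q [] = refl
  count-⊆ {P} {Q} P⊆Q (a ∷ xs) with P a in Pa | Q a in Qa
  ... | true  | true  = cong suc (count-⊆ P⊆Q xs)
  ... | true  | false = contradiction (trans (sym Pa) (⊆ᵇ-false P⊆Q Qa)) λ ()
  ... | false | true  = trans (cong suc (count-⊆ P⊆Q xs)) (sym (+-suc _ _))
  ... | false | false = count-⊆ P⊆Q xs

  count-⊂ : ∀ {P Q : A → Bool} {a xs} → P ⊆ᵇ Q → a ∈ xs → Q a ≡ true → P a ≡ false →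
            count P xs < count Q xs
  count-⊂ {P} {xs = xs} P⊆Q a∈xs Qa Pa = subst (count P xs <_) (sym (count-⊆ P⊆Q xs))
    (m<m+n (count P xs) (count-pos a∈xs (∧-true⁺ Qa (cong not Pa))))

  count≤1⇒unique : ∀ {P : A → Bool} {a b} xs → count P xs ≤ 1 → a ∈ xs → b ∈ xs →
                   P a ≡ true → P b ≡ true → a ≡ b
  count≤1⇒unique (c ∷ xs) _ (here refl) (here refl) _ _ = refl
  count≤1⇒unique (c ∷ xs) le (here refl) (there b∈xs) Pc Pb rewrite Pc =
    contradiction (count-pos b∈xs Pb) (≤⇒≯ (s≤s⁻¹ le))
  count≤1⇒unique (c ∷ xs) le (there a∈xs) (here refl) Pa Pc rewrite Pc =
    contradiction (count-pos a∈xs Pa) (≤⇒≯ (s≤s⁻¹ le))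
  count≤1⇒unique {P} (c ∷ xs) le (there a∈xs) (there b∈xs) Pa Pb with P c
  ... | true  = count≤1⇒unique xs (m≤n⇒m≤1+n (s≤s⁻¹ le)) a∈xs b∈xs Pa Pb
  ... | false = count≤1⇒unique xs le a∈xs b∈xs Pa Pb

  count≡1⇒singleton : ∀ {P : A → Bool} {xs} → (∀ a → a ∈ xs) → count P xs ≡ 1 →
                      Σ A λ a → ∀ b → P b ≡ true ⇔ b ≡ a
  count≡1⇒singleton {xs = xs} complete count≡1
    with a , Pa ← count-pos⁻ xs (subst (0 <_) (sym count≡1) (s≤s z≤n)) =
    a , λ b → mk⇔ (λ Pb → count≤1⇒unique xs count≤1 (complete b) (complete a) Pb Pa) λ { refl → Pa }
    where
    count≤1 = subst (_≤ 1) (sym count≡1) ≤-refl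

injective⇒surjective : ∀ {k} {f : Fin k → Fin k} → Injective _≡_ _≡_ f → Surjective _≡_ _≡_ f
injective⇒surjective {suc k} {f} f-inj y with any? (λ x → f x Fin.≟ y)
... | yes (x , fx≡y) = x , λ { refl → fx≡y }
... | no ∄x = contradiction (injective⇒≤ g-inj) 1+n≰n
  where
  y≢f : ∀ x → y ≢ f x
  y≢f x y≡fx = ∄x (x , sym y≡fx)

  -- Pigeonhole: f misses y, so it would inject Fin (suc k) into Fin k.
  g : Fin (suc k) → Fin k
  g x = punchOut (y≢f x)

  g-inj : Injective _≡_ _≡_ g
  g-inj eq = f-inj (punchOut-injective (y≢f _) (y≢f _) eq)

module _ {a ℓ} {A : Set a} {R : Rel A ℓ} (R-refl : Reflexive R) (R-trans : Transitive R) where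

  sequence-mono : ∀ {m} (c : Fin (suc m) → A) → (∀ t → R (c (inject₁ t)) (c (suc t))) →
                  ∀ {i j} → i Fin.≤ j → R (c i) (c j)
  sequence-mono         _ _    {zero}  {zero}  _ = R-refl
  sequence-mono {suc m} c step {zero}  {suc j} _ =
    R-trans (step zero) (sequence-mono (c ∘ suc) (step ∘ suc) {zero} {j} z≤n)
  sequence-mono {suc m} c step {suc i} {suc j} (s≤s i≤j) =
    sequence-mono (c ∘ suc) (step ∘ suc) i≤j

module _ {n : ℕ} where

  edgeKey : Fin n × Fin n → ℕ × ℕ
  edgeKey (i , j) = toℕ j , toℕ i

  _≺_ : Rel (Fin n × Fin n) 0ℓ
  p ≺ q = ×-Lex _≡_ _<_ _>_ (edgeKey p) (edgeKey q)

  ≺ᵇ≡true⇔≺ : ∀ p q → (p ≺ᵇ q) ≡ true ⇔ p ≺ q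
  ≺ᵇ≡true⇔≺ (i , j) (k , l) =
    ((<ᵇ⇔< ⊎-⇔ ((mk⇔ (≡ᵇ⇒≡ _ _) (≡⇒≡ᵇ _ _) ×-⇔ <ᵇ⇔<) ⇔-∘ T-∧)) ⇔-∘ T-∨) ⇔-∘ ⇔-sym T-≡
    where
    <ᵇ⇔< : ∀ {a b} → T (a <ᵇ b) ⇔ a < b
    <ᵇ⇔< = mk⇔ (<ᵇ⇒< _ _) <⇒<ᵇ

  private
    module Lex = IsStrictTotalOrder
      (×-isStrictTotalOrder <-isStrictTotalOrder (Flip.isStrictTotalOrder <-isStrictTotalOrder))

  ≺-irrefl : ∀ p → ¬ p ≺ p
  ≺-irrefl p = Lex.irrefl (refl , refl)

  ≺-trans : ∀ {p q r} → p ≺ q → q ≺ r → p ≺ r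
  ≺-trans = Lex.trans

  ≢⇒≺⊎≻ : ∀ {p q} → p ≢ q → p ≺ q ⊎ q ≺ p
  ≢⇒≺⊎≻ {i , j} {k , l} p≢q with Lex.compare (edgeKey (i , j)) (edgeKey (k , l))
  ... | tri< p≺q _ _ = inj₁ p≺q
  ... | tri≈ _ (j≡l , i≡k) _ =
    contradiction (cong₂ _,_ (toℕ-injective i≡k) (toℕ-injective j≡l)) p≢q
  ... | tri> _ _ q≺p = inj₂ q≺p

  ≺ᵇ-irrefl : ∀ p → (p ≺ᵇ p) ≡ false
  ≺ᵇ-irrefl p with p ≺ᵇ p in p≺ᵇp
  ... | false = refl
  ... | true = contradiction (to (≺ᵇ≡true⇔≺ p p) p≺ᵇp) (≺-irrefl p)

  ∈-allPairs : ∀ p → p ∈ allPairs n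
  ∈-allPairs (i , j) =
    ∈-concatMap⁺ (λ i → map (i ,_) (allFin n))
      (Any.map (λ { refl → ∈-map⁺ (i ,_) (∈-allFin j) }) (∈-allFin i))

  rank : (Fin n × Fin n → Bool) → Fin n × Fin n → ℕ
  rank D e = count (λ e′ → D e′ ∧ (e′ ≺ᵇ e)) (allPairs n)

  module _ {D : Fin n × Fin n → Bool} where

    private
      not-below-self : ∀ e → D e ∧ (e ≺ᵇ e) ≡ false
      not-below-self e rewrite ≺ᵇ-irrefl e = ∧-zeroʳ (D e)

    rank<count : ∀ {e} → D e ≡ true → rank D e < count D (allPairs n)
    rank<count {e} De = count-⊂ (λ _ → proj₁ ∘ ∧-true⁻) (∈-allPairs e) De (not-below-self e)

    ≺⇒rank< : ∀ {a b} → D a ≡ true → a ≺ b → rank D a < rank D b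
    ≺⇒rank< {a} {b} Da a≺b = count-⊂ below-a⊆below-b (∈-allPairs a) a∈ (not-below-self a)
      where
      below-a⊆below-b : (λ e → D e ∧ (e ≺ᵇ a)) ⊆ᵇ (λ e → D e ∧ (e ≺ᵇ b))
      below-a⊆below-b e h with De , e≺ᵇa ← ∧-true⁻ h =
        ∧-true⁺ De (from (≺ᵇ≡true⇔≺ e b) (≺-trans (to (≺ᵇ≡true⇔≺ e a) e≺ᵇa) a≺b))
      a∈ : D a ∧ (a ≺ᵇ b) ≡ true
      a∈ = ∧-true⁺ Da (from (≺ᵇ≡true⇔≺ a b) a≺b)

    rank-injective : ∀ {a b} → D a ≡ true → D b ≡ true → rank D a ≡ rank D b → a ≡ b
    rank-injective {a} {b} Da Db eq with ≡-dec Fin._≟_ Fin._≟_ a b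
    ... | yes a≡b = a≡b
    ... | no a≢b with ≢⇒≺⊎≻ a≢b
    ...   | inj₁ a≺b = contradiction eq (<⇒≢ (≺⇒rank< Da a≺b))
    ...   | inj₂ b≺a = contradiction (sym eq) (<⇒≢ (≺⇒rank< Db b≺a))

module _ {n : ℕ} {ε : Fin n → Sgn} where

  edges : Net n ε → Fin n × Fin n → Bool
  edges x = uncurry (𝓔 x)

  ⊆E⇒⊆ᵇ : ∀ {E F : EdgeSet n} → E ⊆E F → uncurry E ⊆ᵇ uncurry F
  ⊆E⇒⊆ᵇ E⊆F (i , j) = E⊆F i j

  count-inDiff : ∀ (x y : Net n ε) → edges x ⊆ᵇ edges y →
                 count (inDiff x y) (allPairs n) ≡ ρ y ∸ ρ x
  count-inDiff x y x⊆y = sym (begin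
    ρ y ∸ ρ x                                   ≡⟨ cong (_∸ ρ x) (count-⊆ {P = edges x} x⊆y (allPairs n)) ⟩
    ρ x + count (inDiff x y) (allPairs n) ∸ ρ x ≡⟨ m+n∸m≡n (ρ x) _ ⟩
    count (inDiff x y) (allPairs n)             ∎)
    where open ≡-Reasoning

  cover-label : ∀ {z w : Net n ε} → z ⋖ w →
                Σ (Fin n × Fin n) λ e → ∀ p → inDiff z w p ≡ true ⇔ p ≡ e
  cover-label {z} {w} (ρw≡1+ρz , z⊆w , _) =
    count≡1⇒singleton {P = inDiff z w} ∈-allPairs (begin
    count (inDiff z w) (allPairs n) ≡⟨ count-inDiff z w (⊆E⇒⊆ᵇ z⊆w) ⟩
    ρ w ∸ ρ z                       ≡⟨ cong (_∸ ρ z) ρw≡1+ρz ⟩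
    suc (ρ z) ∸ ρ z                 ≡⟨ m+n∸n≡m 1 (ρ z) ⟩
    1                               ∎)
    where open ≡-Reasoning

  module _ {x y : Net n ε} {m : ℕ} (ch : MaxChain x y m) where
    open MaxChain ch

    chain-⊆ : ∀ {i j} → i Fin.≤ j → edges (c i) ⊆ᵇ edges (c j)
    chain-⊆ = sequence-mono {R = λ u v → edges u ⊆ᵇ edges v} ⊆ᵇ-refl ⊆ᵇ-trans c
                (λ t → ⊆E⇒⊆ᵇ (proj₁ (proj₂ (cover t))))

    x⊆chain : ∀ k → edges x ⊆ᵇ edges (c k)
    x⊆chain k = ⊆ᵇ-trans {Q = edges (c zero)} (λ (i , j) → trans (start i j)) (chain-⊆ z≤n)

    chain⊆y : ∀ k → edges (c k) ⊆ᵇ edges y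
    chain⊆y k =
      ⊆ᵇ-trans {Q = edges (c (fromℕ m))} (chain-⊆ (≤fromℕ k)) (λ (i , j) → trans (sym (end i j)))

    private
      step-label : ∀ t → Σ (Fin n × Fin n) λ e →
                   ∀ p → inDiff (c (inject₁ t)) (c (suc t)) p ≡ true ⇔ p ≡ e
      step-label t = cover-label {c (inject₁ t)} {c (suc t)} (cover t)

    label : Fin m → Fin n × Fin n
    label t = proj₁ (step-label t)

    label-spec : ∀ t p → inDiff (c (inject₁ t)) (c (suc t)) p ≡ true ⇔ p ≡ label t
    label-spec t = proj₂ (step-label t)

    private
      label-added : ∀ t → edges (c (suc t)) (label t) ≡ true × edges (c (inject₁ t)) (label t) ≡ false
      label-added t =
        ∖ᵇ-true⁻ {P = edges (c (inject₁ t))} {Q = edges (c (suc t))} (from (label-spec t (label t)) refl)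

    label∈inDiff : ∀ t → inDiff x y (label t) ≡ true
    label∈inDiff t with in-next , not-in-prev ← label-added t =
      ∧-true⁺ (chain⊆y (suc t) _ in-next) (cong not (⊆ᵇ-false (x⊆chain (inject₁ t)) not-in-prev))

    label-fresh : ∀ {s t} → s Fin.< t → label s ≢ label t
    label-fresh {s} {t} s<t ls≡lt = contradiction (trans (sym present) (proj₂ (label-added t))) λ ()
      where
      s+1≤t : suc s Fin.≤ inject₁ t
      s+1≤t = subst (toℕ (suc s) ≤_) (sym (toℕ-inject₁ t)) s<t

      present : edges (c (inject₁ t)) (label t) ≡ true
      present = chain-⊆ s+1≤t (label t)
        (subst (λ e → edges (c (suc s)) e ≡ true) ls≡lt (proj₁ (label-added s)))

    label-injective : Injective _≡_ _≡_ label
    label-injective {s} {t} ls≡lt with <-cmp s t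
    ... | tri< s<t _ _ = contradiction ls≡lt (label-fresh s<t)
    ... | tri≈ _ s≡t _ = s≡t
    ... | tri> _ _ t<s = contradiction (sym ls≡lt) (label-fresh t<s)

    x⊆y : edges x ⊆ᵇ edges y
    x⊆y = ⊆ᵇ-trans (x⊆chain zero) (chain⊆y zero)

lemma5p9 : ∀ {n : ℕ} (ε : Fin n → Sgn) → FirstNonzeroPos ε →
    (x y : Net n ε) → x ≤P y →
    (ch : MaxChain x y (ρ y ∸ ρ x)) →
    Σ (Fin (ρ y ∸ ρ x) → Fin n × Fin n) (λ ℓ →
      (∀ (t : Fin (ρ y ∸ ρ x)) (i j : Fin n) →
        (inDiff (MaxChain.c ch (inject₁ t)) (MaxChain.c ch (suc t)) (i , j) ≡ true)
          ⇔ ((i , j) ≡ ℓ t))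
      × Σ (Fin (ρ y ∸ ρ x) → Fin (ρ y ∸ ρ x)) (λ σ →
          Bijective _≡_ _≡_ σ × (∀ (t : Fin (ρ y ∸ ρ x)) → toℕ (σ t) ≡ rankIn x y (ℓ t))))
lemma5p9 ε _ x y _ ch =
  label ch , (λ t i j → label-spec ch t (i , j)) ,
  σ , (σ-injective , injective⇒surjective σ-injective) , (λ t → toℕ-fromℕ< _)
  where
  σ : Fin (ρ y ∸ ρ x) → Fin (ρ y ∸ ρ x)
  σ t = fromℕ< (subst (rankIn x y (label ch t) <_) (count-inDiff x y (x⊆y ch))
                       (rank<count {D = inDiff x y} (label∈inDiff ch t)))

  σ-injective : Injective _≡_ _≡_ σ
  σ-injective {s} {t} σs≡σt = label-injective ch
    (rank-injective {D = inDiff x y} (label∈inDiff ch s) (label∈inDiff ch t)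
      (trans (sym (toℕ-fromℕ< _)) (trans (cong toℕ σs≡σt) (toℕ-fromℕ< _))))
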